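{- Let $G$ and $H$ be finite simple graphs containing no isolated vertices. Then \[ \gamma_{pr}(G)\,\gamma_{pr}(H) \le 6\,\gamma_{pr}(G\Box H). \]
   Context: All graphs are finite, simple and undirected. For a graph $G$ and vertex $v$, $N_G[v]$ denotes the closed neighborhood of $v$. A dominating set of $G$ is a set $D\subseteq V(G)$ with $N_G[v]\cap D\neq\emptyset$ for all $v$. A paired dominating set is a dominating set $D$ such that the induced subgraph $G[D]$ has a perfect matching; $\gamma_{pr}(G)$ is the minimum size of a paired dominating set (which exists when $G$ has no isolated vertices). The Cartesian product $G\Box H$ has vertex set $V(G)\times V(H)$, with $gh$ and $g'h'$ adjacent iff either $g=g'$ and $hh'\in E(H)$, or $h=h'$ and $gg'\in E(G)$. -}

module Defs where

open import Data.Nat using (ℕ; _*_)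
open import Data.Fin using (Fin; remQuot)
open import Data.Fin.Subset using (Subset; _∈_; ∣_∣)
open import Data.Product using (Σ; ∃; _×_; _,_; proj₁; proj₂)
open import Data.Sum using (_⊎_)
open import Data.Empty using (⊥)
open import Relation.Nullary using (¬_; Dec)
open import Relation.Binary.PropositionalEquality using (_≡_)
open import Data.Nat using (_≤_)

record Graph (n : ℕ) : Set₁ where
  field
    Adj     : Fin n → Fin n → Set
    adj?    : ∀ u v → Dec (Adj u v)
    irrefl  : ∀ v → ¬ Adj v v
    sym     : ∀ {u v} → Adj u v → Adj v u
open Graph public

NoIsolated : ∀ {n} → Graph n → Set
NoIsolated {n} G = ∀ (v : Fin n) → ∃ λ u → Adj G v u

InClosedNbhd : ∀ {n} → Graph n → Fin n → Fin n → Set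
InClosedNbhd G v u = (u ≡ v) ⊎ Adj G v u

IsDominating : ∀ {n} → Graph n → Subset n → Set
IsDominating {n} G D = ∀ (v : Fin n) → ∃ λ u → InClosedNbhd G v u × u ∈ D

-- G[D] has a perfect matching, given by a partner function on D:
-- each vertex of D is matched to an adjacent vertex of D, and the matching
-- is an involution (so the matched pairs are disjoint edges covering D).
HasPerfectMatching : ∀ {n} → Graph n → Subset n → Set
HasPerfectMatching {n} G D =
  Σ (Fin n → Fin n) λ p →
    ∀ v → v ∈ D → (p v ∈ D) × Adj G v (p v) × (p (p v) ≡ v)

IsPairedDominating : ∀ {n} → Graph n → Subset n → Set
IsPairedDominating G D = IsDominating G D × HasPerfectMatching G D

IsPairedDomNumber : ∀ {n} → Graph n → ℕ → Set
IsPairedDomNumber {n} G k =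
  (Σ (Subset n) λ D → IsPairedDominating G D × ∣ D ∣ ≡ k) ×
  (∀ (D : Subset n) → IsPairedDominating G D → k ≤ ∣ D ∣)

-- Cartesian product G □ H on Fin (m * n), vertex w ↔ remQuot n w = (g , h).
CartAdj : ∀ {m n} → Graph m → Graph n → Fin m × Fin n → Fin m × Fin n → Set
CartAdj G H (g , h) (g' , h') = (g ≡ g' × Adj H h h') ⊎ (h ≡ h' × Adj G g g')

_□_ : ∀ {m n} → Graph m → Graph n → Graph (m * n)
_□_ {m} {n} G H = record
  { Adj    = λ x y → CartAdj G H (remQuot n x) (remQuot n y)
  ; adj?   = λ x y → dec (remQuot n x) (remQuot n y)
  ; irrefl = λ x → irr (remQuot n x)
  ; sym    = λ {x} {y} → sy (remQuot n x) (remQuot n y)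
  }
  where
  open import Data.Fin.Properties using (_≟_)
  open import Relation.Nullary.Decidable using (_×-dec_; _⊎-dec_)
  open import Data.Sum using (inj₁; inj₂)
  open import Relation.Binary.PropositionalEquality using (refl)
  import Relation.Binary.PropositionalEquality as P
  dec : ∀ a b → Dec (CartAdj G H a b)
  dec (g , h) (g' , h') = ((g ≟ g') ×-dec adj? H h h') ⊎-dec ((h ≟ h') ×-dec adj? G g g')
  irr : ∀ a → ¬ CartAdj G H a a
  irr (g , h) (inj₁ (_ , a)) = irrefl H h a
  irr (g , h) (inj₂ (_ , a)) = irrefl G g a
  sy : ∀ a b → CartAdj G H a b → CartAdj G H b a
  sy (g , h) (g' , h') (inj₁ (e , a)) = inj₁ (P.sym e , sym H a)
  sy (g , h) (g' , h') (inj₂ (e , a)) = inj₂ (P.sym e , sym G a)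

module Submission where

-- Fix a minimum paired dominating set D of G □ H with perfect matching p, and a
-- minimum paired dominating set DG of G with matching pG.  Orienting the pairs
-- by the order of Fin, the pairs of DG have first elements Q with |Q| = γpr(G)/2,
-- and every vertex g of G is assigned a "cell" u ∈ Q with g ∈ N[u] ∪ N[pG u].
-- The counting tool is the bound γpr(K) ≤ 2 · #units for any list of units
-- (vertices or edges of K) whose closed neighbourhoods cover K: the units can be
-- grown greedily into a paired dominating set (UnitCover).
-- For a choice β of one element of each pair of D, every x ∈ D contributes one
-- unit (two if β x) to the H-fibre of its cell or to the G-fibre of its row.
-- Applying the unit bound to H once for every u ∈ Q and to G once for every row,
-- and double counting, gives |Q| · γpr(H) ≤ 2 Σ_{x∈D} (1 + [β x])
-- (DoubleCounting).  For the two orientations of D the right-hand sides add up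
-- to 2 · 3|D|, which yields the theorem.

open import Defs renaming (sym to adj-sym)
open import Data.Nat using (ℕ; zero; suc; _+_; _*_; _≤_; z≤n; s≤s)
open import Data.Nat.Properties
  using ( ≤-refl; ≤-reflexive; ≤-trans; n≤1+n; m≤n+m; module ≤-Reasoning
        ; +-comm; +-identityʳ; +-suc; +-mono-≤; +-monoʳ-≤; +-cancelˡ-≤; +-cancelʳ-≤
        ; *-assoc; *-suc; *-distribˡ-+; *-monoˡ-≤; *-monoʳ-≤; *-cancelˡ-≤; +-*-semiring )
open import Data.Fin using (Fin; zero; suc; _<_; remQuot; combine)
open import Data.Fin.Properties using (_≟_; _<?_; <-cmp; <-asym; any?; remQuot-combine)
open import Data.Fin.Subset
  using (Subset; inside; outside; _∈_; _∉_; _⊆_; ∣_∣; _∪_; ⁅_⁆) renaming (⊥ to ∅)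
open import Data.Fin.Subset.Properties
  using (_∈?_; ∣⁅x⁆∣≡1; x∈⁅x⁆; x∈⁅y⁆⇒x≡y; x∈p∪q⁺; x∈p∪q⁻; ∉⊥; ∣⊥∣≡0)
open import Data.List using (List; []; _∷_; _++_; length; [_])
open import Data.List.Properties using (length-++)
open import Data.List.Membership.Propositional using () renaming (_∈_ to _∈ₗ_)
open import Data.List.Membership.Propositional.Properties using (∈-++⁺ˡ; ∈-++⁺ʳ)
open import Data.List.Relation.Unary.Any using (here; there)
open import Data.Product using (Σ; ∃; _×_; _,_; proj₁; proj₂)
open import Data.Sum using (_⊎_; inj₁; inj₂)
import Data.Vec as Vec
open import Data.Bool using (if_then_else_)
open import Data.Empty using (⊥; ⊥-elim)
open import Relation.Nullary using (¬_; Dec; yes; no; does)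
open import Relation.Nullary.Decidable using (_×-dec_; _⊎-dec_; ¬?; decidable-stable)
open import Relation.Binary using (tri<; tri≈; tri>)
open import Relation.Binary.PropositionalEquality
  using (_≡_; _≢_; refl; sym; trans; cong; cong₂; subst; module ≡-Reasoning)
open import Algebra.Properties.Semiring.Sum +-*-semiring
  using ( sum; sum-syntax; sum-cong-≗; sum-replicate-zero
        ; ∑-comm; ∑-distrib-+; *-distribˡ-sum; *-distribʳ-sum )
open import Data.Nat.Solver using (module +-*-Solver)

ind : ∀ {p} {P : Set p} → Dec P → ℕ
ind d = if does d then 1 else 0

exactly-one : ∀ {a b} {A : Set a} {B : Set b} (a? : Dec A) (b? : Dec B) →
  ¬ (A × B) → (¬ A → ¬ B → ⊥) → ind a? + ind b? ≡ 1
exactly-one (yes a) (yes b) not-both _       = ⊥-elim (not-both (a , b))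
exactly-one (yes _) (no _)  _        _       = refl
exactly-one (no _)  (yes _) _        _       = refl
exactly-one (no ¬a) (no ¬b) _        neither = ⊥-elim (neither ¬a ¬b)

ind-split : ∀ {a b} {A : Set a} {B : Set b} (a? : Dec A) (b? : Dec B) →
  ind (a? ×-dec b?) + ind (a? ×-dec ¬? b?) ≡ ind a?
ind-split (yes _) (yes _) = refl
ind-split (yes _) (no _)  = refl
ind-split (no _)  _       = refl

ind*-≤ : ∀ {a} {A : Set a} {b c : ℕ} (a? : Dec A) → (A → b ≤ c) → ind a? * b ≤ c
ind*-≤ {b = b} {c} (yes A) b≤c = subst (_≤ c) (sym (+-identityʳ b)) (b≤c A)
ind*-≤          (no _)  _   = z≤n

-- Charges of a vertex x of D (A: x ∈ D, V: its pair is vertical, B: x is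
-- chosen): the number of units x contributes is at most 1 + [x chosen].
unit-charges : ∀ {a v b} {A : Set a} {V : Set v} {B : Set b} (a? : Dec A) (v? : Dec V) (b? : Dec B) →
  (ind (a? ×-dec ¬? v?) + ind (a? ×-dec v? ×-dec b?)) + (ind (a? ×-dec v?) + ind (a? ×-dec ¬? v? ×-dec b?))
    ≤ ind a? + ind b?
unit-charges (no _)  _       b?      = z≤n
unit-charges (yes _) (yes _) (yes _) = ≤-refl
unit-charges (yes _) (yes _) (no _)  = ≤-refl
unit-charges (yes _) (no _)  (yes _) = ≤-refl
unit-charges (yes _) (no _)  (no _)  = ≤-refl

∑-mono : ∀ {k} {f g : Fin k → ℕ} → (∀ i → f i ≤ g i) → sum f ≤ sum g
∑-mono {zero}  f≤g = z≤n
∑-mono {suc k} f≤g = +-mono-≤ (f≤g zero) (∑-mono (λ i → f≤g (suc i)))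

∑-point : ∀ {l} (y : Fin l) (c : ℕ) → ∑[ u < l ] (ind (y ≟ u) * c) ≡ c
∑-point {suc l} zero    c = trans (cong₂ _+_ (+-identityʳ c) (sum-replicate-zero l)) (+-identityʳ c)
∑-point {suc l} (suc y) c = ∑-point y c

∑-fibres : ∀ {k l} (f : Fin k → Fin l) (w : Fin k → ℕ) →
  ∑[ u < l ] ∑[ x < k ] (ind (f x ≟ u) * w x) ≡ ∑[ x < k ] w x
∑-fibres f w = trans (∑-comm (λ u x → ind (f x ≟ u) * w x)) (sum-cong-≗ (λ x → ∑-point (f x) (w x)))

∣∣-as-∑ : ∀ {k} (Y : Subset k) → ∣ Y ∣ ≡ ∑[ x < k ] ind (x ∈? Y)
∣∣-as-∑ Vec.[]            = refl
∣∣-as-∑ (inside Vec.∷ Y)  = cong₂ _+_ refl (∣∣-as-∑ Y)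
∣∣-as-∑ (outside Vec.∷ Y) = ∣∣-as-∑ Y

∣p∪q∣≤∣p∣+∣q∣ : ∀ {k} (p q : Subset k) → ∣ p ∪ q ∣ ≤ ∣ p ∣ + ∣ q ∣
∣p∪q∣≤∣p∣+∣q∣ Vec.[]              Vec.[]              = z≤n
∣p∪q∣≤∣p∣+∣q∣ (inside Vec.∷ p)  (outside Vec.∷ q)   = s≤s (∣p∪q∣≤∣p∣+∣q∣ p q)
∣p∪q∣≤∣p∣+∣q∣ (inside Vec.∷ p)  (inside Vec.∷ q)    =
  s≤s (≤-trans (∣p∪q∣≤∣p∣+∣q∣ p q) (+-monoʳ-≤ ∣ p ∣ (n≤1+n ∣ q ∣)))
∣p∪q∣≤∣p∣+∣q∣ (outside Vec.∷ p) (outside Vec.∷ q)   = ∣p∪q∣≤∣p∣+∣q∣ p q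
∣p∪q∣≤∣p∣+∣q∣ (outside Vec.∷ p) (inside Vec.∷ q)    =
  ≤-trans (s≤s (∣p∪q∣≤∣p∣+∣q∣ p q)) (≤-reflexive (sym (+-suc ∣ p ∣ ∣ q ∣)))

∣⁅x⁆∪p∣≤1+∣p∣ : ∀ {k} (x : Fin k) (p : Subset k) → ∣ ⁅ x ⁆ ∪ p ∣ ≤ suc ∣ p ∣
∣⁅x⁆∪p∣≤1+∣p∣ x p = ≤-trans (∣p∪q∣≤∣p∣+∣q∣ ⁅ x ⁆ p) (≤-reflexive (cong₂ _+_ (∣⁅x⁆∣≡1 x) refl))

module _ {a} {A : Set a} where

  when : ∀ {p} {P : Set p} → Dec P → List A → List A
  when (yes _) xs = xs
  when (no _)  xs = []

  length-when : ∀ {p} {P : Set p} (d : Dec P) (xs : List A) → length (when d xs) ≡ ind d * length xs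
  length-when (yes _) xs = sym (+-identityʳ (length xs))
  length-when (no _)  xs = refl

  ∈-when : ∀ {p} {P : Set p} (d : Dec P) {xs : List A} {y : A} → P → y ∈ₗ xs → y ∈ₗ when d xs
  ∈-when (yes _) _  y∈ = y∈
  ∈-when (no ¬P) pf _  = ⊥-elim (¬P pf)

  given : ∀ {p} {P : Set p} → Dec P → (P → A) → List A
  given (yes pf) f = [ f pf ]
  given (no _)   f = []

  length-given : ∀ {p} {P : Set p} (d : Dec P) (f : P → A) → length (given d f) ≡ ind d
  length-given (yes _) f = refl
  length-given (no _)  f = refl

  ∈-given : ∀ {p} {P : Set p} (d : Dec P) (f : P → A) → P → ∃ λ pf → f pf ∈ₗ given d f
  ∈-given (yes pf) f _  = pf , here refl
  ∈-given (no ¬P)  f pf = ⊥-elim (¬P pf)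

  length-given₂ : ∀ {p q} {P : Set p} {R : Set q} (d : Dec P) (f : P → A) (e : Dec R) (g : R → A) →
    length (given d f ++ given e g) ≡ ind d + ind e
  length-given₂ d f e g = trans (length-++ (given d f)) (cong₂ _+_ (length-given d f) (length-given e g))

  gather : ∀ {k} → (Fin k → List A) → List A
  gather {zero}  f = []
  gather {suc k} f = f zero ++ gather (λ i → f (suc i))

  length-gather : ∀ {k} (f : Fin k → List A) → length (gather f) ≡ ∑[ i < k ] length (f i)
  length-gather {zero}  f = refl
  length-gather {suc k} f = trans (length-++ (f zero)) (cong₂ _+_ refl (length-gather (λ i → f (suc i))))

  ∈-gather : ∀ {k} (f : Fin k → List A) (i : Fin k) {y : A} → y ∈ₗ f i → y ∈ₗ gather f
  ∈-gather {suc k} f zero    y∈ = ∈-++⁺ˡ y∈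
  ∈-gather {suc k} f (suc i) y∈ = ∈-++⁺ʳ (f zero) (∈-gather (λ j → f (suc j)) i y∈)

closed? : ∀ {k} (K : Graph k) (v u : Fin k) → Dec (InClosedNbhd K v u)
closed? K v u = (u ≟ v) ⊎-dec adj? K v u

PartnerOn : ∀ {k} → Graph k → Subset k → (Fin k → Fin k) → Set
PartnerOn K S q = ∀ v → v ∈ S → (q v ∈ S) × Adj K v (q v) × (q (q v) ≡ v)

module _ {k} (K : Graph k) {S : Subset k} {q : Fin k → Fin k} (match : PartnerOn K S q) where

  partner-∈ : ∀ {v} → v ∈ S → q v ∈ S
  partner-∈ {v} v∈ = proj₁ (match v v∈)

  partner-adj : ∀ {v} → v ∈ S → Adj K v (q v)
  partner-adj {v} v∈ = proj₁ (proj₂ (match v v∈))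

  partner-invol : ∀ {v} → v ∈ S → q (q v) ≡ v
  partner-invol {v} v∈ = proj₂ (proj₂ (match v v∈))

  partner-≢ : ∀ {v} → v ∈ S → v ≢ q v
  partner-≢ {v} v∈ v≡qv = irrefl K v (subst (Adj K v) (sym v≡qv) (partner-adj v∈))

weight : ∀ {k} {β : Fin k → Set} → Subset k → (∀ v → Dec (β v)) → Fin k → ℕ
weight S β? v = ind (v ∈? S) + ind (β? v)

-- A fixed-point-free involution q of S, oriented by the order of Fin: each pair
-- {v, q v} has exactly one First and one Second element.
module Orientation {k} {S : Subset k} {q : Fin k → Fin k}
  (closed : ∀ {v} → v ∈ S → q v ∈ S) (invol : ∀ {v} → v ∈ S → q (q v) ≡ v)
  (no-fix : ∀ {v} → v ∈ S → v ≢ q v) where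

  First Second : Fin k → Set
  First  v = v ∈ S × v < q v
  Second v = v ∈ S × q v < v

  First? : ∀ v → Dec (First v)
  First? v = (v ∈? S) ×-dec (v <? q v)

  Second? : ∀ v → Dec (Second v)
  Second? v = (v ∈? S) ×-dec (q v <? v)

  first-rep : ∀ v → v ∈ S → First v ⊎ First (q v)
  first-rep v v∈ with <-cmp v (q v)
  ... | tri< v<qv _ _ = inj₁ (v∈ , v<qv)
  ... | tri≈ _ v≡qv _ = ⊥-elim (no-fix v∈ v≡qv)
  ... | tri> _ _ qv<v = inj₂ (closed v∈ , subst (q v <_) (sym (invol v∈)) qv<v)

  second-rep : ∀ v → v ∈ S → Second v ⊎ Second (q v)
  second-rep v v∈ with <-cmp v (q v)
  ... | tri> _ _ qv<v = inj₁ (v∈ , qv<v)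
  ... | tri≈ _ v≡qv _ = ⊥-elim (no-fix v∈ v≡qv)
  ... | tri< v<qv _ _ = inj₂ (closed v∈ , subst (_< q v) (sym (invol v∈)) v<qv)

  first+second : ∀ v → ind (First? v) + ind (Second? v) ≡ ind (v ∈? S)
  first+second v with v ∈? S
  ... | no _  = refl
  ... | yes v∈ = exactly-one (v <? q v) (q v <? v) (λ (v<qv , qv<v) → <-asym v<qv qv<v) trichotomy
    where
    trichotomy : ¬ v < q v → ¬ q v < v → ⊥
    trichotomy v≮qv qv≮v with <-cmp v (q v)
    ... | tri< v<qv _ _ = v≮qv v<qv
    ... | tri≈ _ v≡qv _ = no-fix v∈ v≡qv
    ... | tri> _ _ qv<v = qv≮v qv<v

  first+second-count : ∑[ v < k ] ind (First? v) + ∑[ v < k ] ind (Second? v) ≡ ∣ S ∣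
  first+second-count = begin
    ∑[ v < k ] ind (First? v) + ∑[ v < k ] ind (Second? v) ≡⟨ ∑-distrib-+ (λ v → ind (First? v)) _ ⟨
    ∑[ v < k ] (ind (First? v) + ind (Second? v))          ≡⟨ sum-cong-≗ first+second ⟩
    ∑[ v < k ] ind (v ∈? S)                                 ≡⟨ ∣∣-as-∑ S ⟨
    ∣ S ∣                                                   ∎
    where open ≡-Reasoning

  weight-total : ∑[ v < k ] weight S First? v + ∑[ v < k ] weight S Second? v ≡ 3 * ∣ S ∣
  weight-total = begin
    ∑[ v < k ] weight S First? v + ∑[ v < k ] weight S Second? v ≡⟨ ∑-distrib-+ (weight S First?) _ ⟨
    ∑[ v < k ] (weight S First? v + weight S Second? v)          ≡⟨ sum-cong-≗ pointwise ⟩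
    ∑[ v < k ] (3 * ind (v ∈? S))                                 ≡⟨ *-distribˡ-sum 3 (λ v → ind (v ∈? S)) ⟨
    3 * ∑[ v < k ] ind (v ∈? S)                                   ≡⟨ cong (3 *_) (∣∣-as-∑ S) ⟨
    3 * ∣ S ∣                                                     ∎
    where
    open ≡-Reasoning
    pointwise : ∀ v → weight S First? v + weight S Second? v ≡ 3 * ind (v ∈? S)
    pointwise v = begin
      (s + f) + (s + t) ≡⟨ solve 3 (λ s f t → (s :+ f) :+ (s :+ t) := (s :+ s) :+ (f :+ t)) refl s f t ⟩
      (s + s) + (f + t) ≡⟨ cong ((s + s) +_) (first+second v) ⟩
      (s + s) + s       ≡⟨ solve 1 (λ s → (s :+ s) :+ s := con 3 :* s) refl s ⟩
      3 * s             ∎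
      where
      open +-*-Solver
      s = ind (v ∈? S)
      f = ind (First? v)
      t = ind (Second? v)

data Unit {k} (K : Graph k) : Set where
  single : Fin k → Unit K
  pair   : (x y : Fin k) → Adj K x y → Unit K

_∈ᵤ_ : ∀ {k} {K : Graph k} → Fin k → Unit K → Set
v ∈ᵤ single x   = v ≡ x
v ∈ᵤ pair x y _ = v ≡ x ⊎ v ≡ y

DominatedBy : ∀ {k} (K : Graph k) → List (Unit K) → Set
DominatedBy {k} K us = ∀ (v : Fin k) → ∃ λ U → U ∈ₗ us × ∃ λ x → x ∈ᵤ U × InClosedNbhd K v x

-- The units are processed in
-- turn, growing a matched set by at most two vertices per unit so that every
-- vertex of every processed unit is secured (its whole closed neighbourhood is
-- dominated).
module UnitCover {k} (K : Graph k) (noIso : NoIsolated K) where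

  Secured : Subset k → Fin k → Set
  Secured Y x = ∀ v → InClosedNbhd K v x → ∃ λ y → InClosedNbhd K v y × y ∈ Y

  member-secured : ∀ {Y x} → x ∈ Y → Secured Y x
  member-secured {x = x} x∈Y v x∈N[v] = x , x∈N[v] , x∈Y

  neighbours-secured : ∀ {Y x} → (∀ z → Adj K x z → z ∈ Y) → Secured Y x
  neighbours-secured {x = x} nbrs∈Y v (inj₁ refl) = let (z , x~z) = noIso x in z , inj₂ x~z , nbrs∈Y z x~z
  neighbours-secured {x = x} nbrs∈Y v (inj₂ v~x) = v , inj₁ refl , nbrs∈Y v (adj-sym K v~x)

  secured-mono : ∀ {Y Y′ x} → Y ⊆ Y′ → Secured Y x → Secured Y′ x
  secured-mono Y⊆Y′ sec v x∈N[v] = let (y , y∈N[v] , y∈Y) = sec v x∈N[v] in y , y∈N[v] , Y⊆Y′ y∈Y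

  rematch : (Fin k → Fin k) → Fin k → Fin k → Fin k → Fin k
  rematch p x z v with v ≟ x | v ≟ z
  ... | yes _ | _     = z
  ... | no _  | yes _ = x
  ... | no _  | no _  = p v

  rematch-x : ∀ p x z → rematch p x z x ≡ z
  rematch-x p x z with x ≟ x | x ≟ z
  ... | yes _   | _ = refl
  ... | no x≢x  | _ = ⊥-elim (x≢x refl)

  rematch-z : ∀ p x z → z ≢ x → rematch p x z z ≡ x
  rematch-z p x z z≢x with z ≟ x | z ≟ z
  ... | yes z≡x | _       = ⊥-elim (z≢x z≡x)
  ... | no _    | yes _   = refl
  ... | no _    | no z≢z  = ⊥-elim (z≢z refl)

  rematch-other : ∀ p x z v → v ≢ x → v ≢ z → rematch p x z v ≡ p v
  rematch-other p x z v v≢x v≢z with v ≟ x | v ≟ z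
  ... | yes v≡x | _       = ⊥-elim (v≢x v≡x)
  ... | no _    | yes v≡z = ⊥-elim (v≢z v≡z)
  ... | no _    | no _    = refl

  module Extend {Y : Subset k} {p : Fin k → Fin k} (match : PartnerOn K Y p)
                {x z : Fin k} (x∉Y : x ∉ Y) (z∉Y : z ∉ Y) (x~z : Adj K x z) where

    Y⁺ : Subset k
    Y⁺ = ⁅ x ⁆ ∪ (⁅ z ⁆ ∪ Y)

    x∈Y⁺ : x ∈ Y⁺
    x∈Y⁺ = x∈p∪q⁺ (inj₁ (x∈⁅x⁆ x))

    z∈Y⁺ : z ∈ Y⁺
    z∈Y⁺ = x∈p∪q⁺ (inj₂ (x∈p∪q⁺ (inj₁ (x∈⁅x⁆ z))))

    Y⊆Y⁺ : Y ⊆ Y⁺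
    Y⊆Y⁺ v∈Y = x∈p∪q⁺ (inj₂ (x∈p∪q⁺ (inj₂ v∈Y)))

    ∣Y⁺∣≤2+∣Y∣ : ∣ Y⁺ ∣ ≤ 2 + ∣ Y ∣
    ∣Y⁺∣≤2+∣Y∣ = ≤-trans (∣⁅x⁆∪p∣≤1+∣p∣ x (⁅ z ⁆ ∪ Y)) (s≤s (∣⁅x⁆∪p∣≤1+∣p∣ z Y))

    ∈Y⁺-cases : ∀ {v} → v ∈ Y⁺ → v ≡ x ⊎ v ≡ z ⊎ v ∈ Y
    ∈Y⁺-cases v∈ with x∈p∪q⁻ ⁅ x ⁆ (⁅ z ⁆ ∪ Y) v∈
    ... | inj₁ v∈⁅x⁆ = inj₁ (x∈⁅y⁆⇒x≡y x v∈⁅x⁆)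
    ... | inj₂ v∈′ with x∈p∪q⁻ ⁅ z ⁆ Y v∈′
    ...   | inj₁ v∈⁅z⁆ = inj₂ (inj₁ (x∈⁅y⁆⇒x≡y z v∈⁅z⁆))
    ...   | inj₂ v∈Y   = inj₂ (inj₂ v∈Y)

    p⁺ : Fin k → Fin k
    p⁺ = rematch p x z

    z≢x : z ≢ x
    z≢x refl = irrefl K x x~z

    p⁺-on-Y : ∀ {v} → v ∈ Y → p⁺ v ≡ p v
    p⁺-on-Y {v} v∈Y = rematch-other p x z v (λ { refl → x∉Y v∈Y }) (λ { refl → z∉Y v∈Y })

    match⁺ : PartnerOn K Y⁺ p⁺
    match⁺ v v∈ with ∈Y⁺-cases v∈
    ... | inj₁ refl =
      subst (_∈ Y⁺) (sym (rematch-x p x z)) z∈Y⁺ ,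
      subst (Adj K x) (sym (rematch-x p x z)) x~z ,
      trans (cong p⁺ (rematch-x p x z)) (rematch-z p x z z≢x)
    ... | inj₂ (inj₁ refl) =
      subst (_∈ Y⁺) (sym (rematch-z p x z z≢x)) x∈Y⁺ ,
      subst (Adj K z) (sym (rematch-z p x z z≢x)) (adj-sym K x~z) ,
      trans (cong p⁺ (rematch-z p x z z≢x)) (rematch-x p x z)
    ... | inj₂ (inj₂ v∈Y) =
      subst (_∈ Y⁺) (sym (p⁺-on-Y v∈Y)) (Y⊆Y⁺ (partner-∈ K match v∈Y)) ,
      subst (Adj K v) (sym (p⁺-on-Y v∈Y)) (partner-adj K match v∈Y) ,
      (begin
        p⁺ (p⁺ v) ≡⟨ cong p⁺ (p⁺-on-Y v∈Y) ⟩
        p⁺ (p v)  ≡⟨ p⁺-on-Y (partner-∈ K match v∈Y) ⟩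
        p (p v)   ≡⟨ partner-invol K match v∈Y ⟩
        v         ∎)
      where open ≡-Reasoning

  record Extension (Y : Subset k) (Goal : Subset k → Set) : Set where
    field
      Y′     : Subset k
      p′     : Fin k → Fin k
      match′ : PartnerOn K Y′ p′
      grows  : Y ⊆ Y′
      small  : ∣ Y′ ∣ ≤ 2 + ∣ Y ∣
      goal   : Goal Y′
  open Extension

  keep : ∀ {Y p Goal} → PartnerOn K Y p → Goal Y → Extension Y Goal
  keep {Y} {p} match g = record
    { Y′ = Y ; p′ = p ; match′ = match ; grows = λ v∈ → v∈ ; small = m≤n+m ∣ Y ∣ 2 ; goal = g }

  refocus : ∀ {Y Goal Goal′} (e : Extension Y Goal) → Goal′ (Y′ e) → Extension Y Goal′
  refocus e g′ = record
    { Y′ = Y′ e ; p′ = p′ e ; match′ = match′ e ; grows = grows e ; small = small e ; goal = g′ }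

  add-edge : ∀ {Y p Goal} (match : PartnerOn K Y p) {x z} (x∉Y : x ∉ Y) (z∉Y : z ∉ Y) (x~z : Adj K x z) →
    (x ∈ Extend.Y⁺ match x∉Y z∉Y x~z → z ∈ Extend.Y⁺ match x∉Y z∉Y x~z → Goal (Extend.Y⁺ match x∉Y z∉Y x~z)) →
    Extension Y Goal
  add-edge match x∉Y z∉Y x~z g = record
    { Y′ = Y⁺ ; p′ = p⁺ ; match′ = match⁺ ; grows = Y⊆Y⁺ ; small = ∣Y⁺∣≤2+∣Y∣ ; goal = g x∈Y⁺ z∈Y⁺ }
    where open Extend match x∉Y z∉Y x~z

  secure : ∀ {Y p} → PartnerOn K Y p → (x : Fin k) → Extension Y (λ Y′ → Secured Y′ x)
  secure {Y} match x with x ∈? Y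
  ... | yes x∈Y = keep match (member-secured x∈Y)
  ... | no x∉Y with any? (λ z → adj? K x z ×-dec ¬? (z ∈? Y))
  ...   | yes (z , x~z , z∉Y) = add-edge match x∉Y z∉Y x~z (λ x∈ _ → member-secured x∈)
  ...   | no no-free-nbr = keep match (neighbours-secured nbrs∈Y)
    where
    nbrs∈Y : ∀ z → Adj K x z → z ∈ Y
    nbrs∈Y z x~z = decidable-stable (z ∈? Y) (λ z∉Y → no-free-nbr (z , x~z , z∉Y))

  Covers : Unit K → Subset k → Set
  Covers U Y = ∀ x → x ∈ᵤ U → Secured Y x

  secure-unit : ∀ {Y p} → PartnerOn K Y p → (U : Unit K) → Extension Y (Covers U)
  secure-unit match (single x) = refocus e (λ { _ refl → goal e })
    where e = secure match x
  secure-unit {Y} match (pair x y x~y) with x ∈? Y | y ∈? Y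
  ... | yes x∈Y | _ = refocus e (λ { _ (inj₁ refl) → member-secured (grows e x∈Y) ; _ (inj₂ refl) → goal e })
    where e = secure match y
  ... | no _ | yes y∈Y = refocus e (λ { _ (inj₁ refl) → goal e ; _ (inj₂ refl) → member-secured (grows e y∈Y) })
    where e = secure match x
  ... | no x∉Y | no y∉Y = add-edge match x∉Y y∉Y x~y
    (λ x∈ y∈ → λ { _ (inj₁ refl) → member-secured x∈ ; _ (inj₂ refl) → member-secured y∈ })

  secure-all : (us : List (Unit K)) → Σ (Subset k) λ Y →
    HasPerfectMatching K Y × ∣ Y ∣ ≤ 2 * length us × (∀ {U} → U ∈ₗ us → Covers U Y)
  secure-all [] = ∅ , ((λ v → v) , λ v v∈∅ → ⊥-elim (∉⊥ v∈∅)) , ≤-reflexive (∣⊥∣≡0 k) , λ ()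
  secure-all (U ∷ us) with secure-all us
  ... | Y , (p , match) , ∣Y∣≤ , covers = Y′ e , (p′ e , match′ e) , size , covers′
    where
    e = secure-unit match U
    size : ∣ Y′ e ∣ ≤ 2 * suc (length us)
    size = ≤-trans (small e) (≤-trans (+-monoʳ-≤ 2 ∣Y∣≤) (≤-reflexive (sym (*-suc 2 (length us)))))
    covers′ : ∀ {V} → V ∈ₗ U ∷ us → Covers V (Y′ e)
    covers′ (here refl) = goal e
    covers′ (there V∈) x x∈V = secured-mono (grows e) (covers V∈ x x∈V)

  unit-cover-bound : ∀ {a} → IsPairedDomNumber K a → ∀ us → DominatedBy K us → a ≤ 2 * length us
  unit-cover-bound (_ , minimal) us dom with secure-all us
  ... | Y , matching , ∣Y∣≤ , covers = ≤-trans (minimal Y (dominating , matching)) ∣Y∣≤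
    where
    dominating : IsDominating K Y
    dominating v = let (U , U∈ , x , x∈U , x∈N[v]) = dom v in covers U∈ x x∈U v x∈N[v]

-- Every vertex g is assigned the
-- cell of a representative u with g ∈ N[u] ∪ N[q u]; the representative pairs
-- form a dominating list of units, so γpr(K) ≤ 2|Q|.
module Representatives {k} (K : Graph k) {S : Subset k} {q : Fin k → Fin k}
  (match : PartnerOn K S q) (dom : IsDominating K S)
  {Q : Fin k → Set} (Q? : ∀ u → Dec (Q u))
  (Q⊆S : ∀ {u} → Q u → u ∈ S) (Q-rep : ∀ v → v ∈ S → Q v ⊎ Q (q v)) where

  repPair : ∀ u → Q u → Unit K
  repPair u Qu = pair u (q u) (partner-adj K match (Q⊆S Qu))

  -- g is dominated by some v ∈ S; either v or its partner is a representative.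
  cell-spec : ∀ g → Σ (Fin k) λ u → Q u × (InClosedNbhd K g u ⊎ InClosedNbhd K g (q u))
  cell-spec g with dom g
  ... | v , v∈N[g] , v∈S with Q-rep v v∈S
  ...   | inj₁ Qv  = v , Qv , inj₁ v∈N[g]
  ...   | inj₂ Qqv = q v , Qqv , inj₂ (subst (InClosedNbhd K g) (sym (partner-invol K match v∈S)) v∈N[g])

  cell : Fin k → Fin k
  cell g = proj₁ (cell-spec g)

  cell-rep : ∀ g → Q (cell g)
  cell-rep g = proj₁ (proj₂ (cell-spec g))

  near-cell : ∀ g (Qc : Q (cell g)) → ∃ λ y → y ∈ᵤ repPair (cell g) Qc × InClosedNbhd K g y
  near-cell g Qc with proj₂ (proj₂ (cell-spec g))
  ... | inj₁ near = cell g , inj₁ refl , near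
  ... | inj₂ near = q (cell g) , inj₂ refl , near

  count : ℕ
  count = ∑[ u < k ] ind (Q? u)

  rep-bound : NoIsolated K → ∀ {a} → IsPairedDomNumber K a → a ≤ 2 * count
  rep-bound noIso aP = ≤-trans (unit-cover-bound aP reps dominated) (≤-reflexive (cong (2 *_) length-reps))
    where
    open UnitCover K noIso using (unit-cover-bound)
    reps : List (Unit K)
    reps = gather (λ u → given (Q? u) (repPair u))
    length-reps : length reps ≡ count
    length-reps = trans (length-gather (λ u → given (Q? u) (repPair u)))
                        (sum-cong-≗ (λ u → length-given (Q? u) (repPair u)))
    dominated : DominatedBy K reps
    dominated g =
      let (Qc , U∈) = ∈-given (Q? (cell g)) (repPair (cell g)) (cell-rep g)
          (y , y∈U , near) = near-cell g Qc
      in repPair (cell g) Qc , ∈-gather _ (cell g) U∈ , y , y∈U , near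

module ProductCoordinates {m n} (G : Graph m) (H : Graph n) where

  col : Fin (m * n) → Fin m
  col x = proj₁ (remQuot {m} n x)

  row : Fin (m * n) → Fin n
  row x = proj₂ (remQuot {m} n x)

  product-nbhd : ∀ {g h x} → InClosedNbhd (G □ H) (combine g h) x →
    (col x ≡ g × InClosedNbhd H h (row x)) ⊎ (row x ≡ h × Adj G g (col x))
  product-nbhd {g} {h} (inj₁ refl) =
    inj₁ (cong proj₁ (remQuot-combine {m} {n} g h) , inj₁ (cong proj₂ (remQuot-combine {m} {n} g h)))
  product-nbhd {g} {h} {x} (inj₂ adj)
    with subst (λ w → CartAdj G H w (remQuot {m} n x)) (remQuot-combine {m} {n} g h) adj
  ... | inj₁ (g≡ , h~) = inj₁ (sym g≡ , inj₂ h~)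
  ... | inj₂ (h≡ , g~) = inj₂ (sym h≡ , g~)

-- A pair {x, p x} of D is vertical when it lies in one G-column (an edge of H),
-- horizontal otherwise (an edge of G, both ends in the same row).
module DoubleCounting {m n} (G : Graph m) (H : Graph n) (noG : NoIsolated G) (noH : NoIsolated H)
  {DG : Subset m} {pG : Fin m → Fin m} (matchG : PartnerOn G DG pG) (domG : IsDominating G DG)
  {Q : Fin m → Set} (Q? : ∀ u → Dec (Q u))
  (Q⊆DG : ∀ {u} → Q u → u ∈ DG) (Q-rep : ∀ v → v ∈ DG → Q v ⊎ Q (pG v))
  {D : Subset (m * n)} {p : Fin (m * n) → Fin (m * n)}
  (matchD : PartnerOn (G □ H) D p) (domD : IsDominating (G □ H) D)
  {β : Fin (m * n) → Set} (β? : ∀ x → Dec (β x)) (β-rep : ∀ x → x ∈ D → β x ⊎ β (p x)) where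

  open Representatives G matchG domG Q? Q⊆DG Q-rep
  open ProductCoordinates G H

  Vertical : Fin (m * n) → Set
  Vertical x = col (p x) ≡ col x

  Vertical? : ∀ x → Dec (Vertical x)
  Vertical? x = col (p x) ≟ col x

  vertical-adj : ∀ {x} → x ∈ D → Vertical x → Adj H (row x) (row (p x))
  vertical-adj {x} x∈D vert with partner-adj (G □ H) matchD x∈D
  ... | inj₁ (_ , r~r′) = r~r′
  ... | inj₂ (_ , c~c′) = ⊥-elim (irrefl G (col x) (subst (Adj G (col x)) vert c~c′))

  horizontal-adj : ∀ {x} → x ∈ D → ¬ Vertical x → row (p x) ≡ row x × Adj G (col x) (col (p x))
  horizontal-adj x∈D ¬vert with partner-adj (G □ H) matchD x∈D
  ... | inj₁ (c≡c′ , _) = ⊥-elim (¬vert (sym c≡c′))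
  ... | inj₂ (r≡r′ , c~c′) = sym r≡r′ , c~c′

  partner-in-D : ∀ {x} → x ∈ D → p x ∈ D
  partner-in-D = partner-∈ (G □ H) matchD

  partner-back : ∀ {x} → x ∈ D → p (p x) ≡ x
  partner-back = partner-invol (G □ H) matchD

  partner-vertical : ∀ {x} → x ∈ D → Vertical x → Vertical (p x)
  partner-vertical x∈D vert = trans (cong col (partner-back x∈D)) (sym vert)

  partner-horizontal : ∀ {x} → x ∈ D → ¬ Vertical x → ¬ Vertical (p x)
  partner-horizontal x∈D ¬vert vert′ = ¬vert (sym (trans (sym (cong col (partner-back x∈D))) vert′))

  partner-β : ∀ {x} → x ∈ D → ¬ β x → β (p x)
  partner-β {x} x∈D ¬βx with β-rep x x∈D
  ... | inj₁ βx  = ⊥-elim (¬βx βx)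
  ... | inj₂ βpx = βpx

  HorizontalIn? : ∀ x → Dec (x ∈ D × ¬ Vertical x)
  HorizontalIn? x = (x ∈? D) ×-dec ¬? (Vertical? x)

  VerticalIn? : ∀ x → Dec (x ∈ D × Vertical x)
  VerticalIn? x = (x ∈? D) ×-dec Vertical? x

  ChosenHorizontal? : ∀ x → Dec (x ∈ D × ¬ Vertical x × β x)
  ChosenHorizontal? x = (x ∈? D) ×-dec ¬? (Vertical? x) ×-dec β? x

  ChosenVertical? : ∀ x → Dec (x ∈ D × Vertical x × β x)
  ChosenVertical? x = (x ∈? D) ×-dec Vertical? x ×-dec β? x

  rowPair : ∀ x → x ∈ D × Vertical x × β x → Unit H
  rowPair x (x∈D , vert , _) = pair (row x) (row (p x)) (vertical-adj x∈D vert)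

  colPair : ∀ x → x ∈ D × ¬ Vertical x × β x → Unit G
  colPair x (x∈D , ¬vert , _) = pair (col x) (col (p x)) (proj₂ (horizontal-adj x∈D ¬vert))

  unitsH : Fin (m * n) → List (Unit H)
  unitsH x = given (HorizontalIn? x) (λ _ → single (row x)) ++ given (ChosenVertical? x) (rowPair x)

  unitsG : Fin (m * n) → List (Unit G)
  unitsG x = given (VerticalIn? x) (λ _ → single (col x)) ++ given (ChosenHorizontal? x) (colPair x)

  H-single : ∀ {x} → x ∈ D → ¬ Vertical x → single (row x) ∈ₗ unitsH x
  H-single {x} x∈D ¬vert =
    ∈-++⁺ˡ (proj₂ (∈-given (HorizontalIn? x) (λ _ → single (row x)) (x∈D , ¬vert)))

  H-pair : ∀ {x} → x ∈ D → Vertical x → β x → ∃ λ U → U ∈ₗ unitsH x × row x ∈ᵤ U × row (p x) ∈ᵤ U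
  H-pair {x} x∈D vert βx =
    _ , ∈-++⁺ʳ _ (proj₂ (∈-given (ChosenVertical? x) (rowPair x) (x∈D , vert , βx))) , inj₁ refl , inj₂ refl

  G-single : ∀ {x} → x ∈ D → Vertical x → single (col x) ∈ₗ unitsG x
  G-single {x} x∈D vert =
    ∈-++⁺ˡ (proj₂ (∈-given (VerticalIn? x) (λ _ → single (col x)) (x∈D , vert)))

  G-pair : ∀ {x} → x ∈ D → ¬ Vertical x → β x → ∃ λ U → U ∈ₗ unitsG x × col x ∈ᵤ U × col (p x) ∈ᵤ U
  G-pair {x} x∈D ¬vert βx =
    _ , ∈-++⁺ʳ _ (proj₂ (∈-given (ChosenHorizontal? x) (colPair x) (x∈D , ¬vert , βx))) , inj₁ refl , inj₂ refl

  units-count : ∀ x → length (unitsH x) + length (unitsG x) ≤ weight D β? x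
  units-count x = subst (_≤ weight D β? x) (sym lengths) (unit-charges (x ∈? D) (Vertical? x) (β? x))
    where
    lengths : length (unitsH x) + length (unitsG x) ≡
      (ind (HorizontalIn? x) + ind (ChosenVertical? x)) + (ind (VerticalIn? x) + ind (ChosenHorizontal? x))
    lengths = cong₂ _+_ (length-given₂ (HorizontalIn? x) (λ _ → single (row x)) (ChosenVertical? x) (rowPair x))
                        (length-given₂ (VerticalIn? x) (λ _ → single (col x)) (ChosenHorizontal? x) (colPair x))

  column-cover : ∀ {x} → x ∈ D → ∃ λ x′ → col x′ ≡ col x × ∃ λ U → U ∈ₗ unitsH x′ × row x ∈ᵤ U
  column-cover {x} x∈D with Vertical? x | β? x
  ... | no ¬vert | _      = x , refl , single (row x) , H-single x∈D ¬vert , refl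
  ... | yes vert | yes βx = let (U , U∈ , row∈ , _) = H-pair x∈D vert βx in x , refl , U , U∈ , row∈
  ... | yes vert | no ¬βx =
    let (U , U∈ , _ , row∈) = H-pair (partner-in-D x∈D) (partner-vertical x∈D vert) (partner-β x∈D ¬βx)
    in p x , vert , U , U∈ , subst (_∈ᵤ U) (cong row (partner-back x∈D)) row∈

  row-cover : ∀ {x} → x ∈ D → ∃ λ x′ → row x′ ≡ row x × ∃ λ U → U ∈ₗ unitsG x′ × col x ∈ᵤ U
  row-cover {x} x∈D with Vertical? x | β? x
  ... | yes vert | _       = x , refl , single (col x) , G-single x∈D vert , refl
  ... | no ¬vert | yes βx = let (U , U∈ , col∈ , _) = G-pair x∈D ¬vert βx in x , refl , U , U∈ , col∈
  ... | no ¬vert | no ¬βx =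
    let (U , U∈ , _ , col∈) = G-pair (partner-in-D x∈D) (partner-horizontal x∈D ¬vert) (partner-β x∈D ¬βx)
    in p x , proj₁ (horizontal-adj x∈D ¬vert) , U , U∈ , subst (_∈ᵤ U) (cong col (partner-back x∈D)) col∈

  Sees : Fin m → Fin n → Set
  Sees u h = ∃ λ x → x ∈ D × cell (col x) ≡ u × InClosedNbhd H h (row x)

  sees? : ∀ u h → Dec (Sees u h)
  sees? u h = any? (λ x → (x ∈? D) ×-dec (cell (col x) ≟ u) ×-dec closed? H h (row x))

  cellUnits : Fin m → List (Unit H)
  cellUnits u = gather (λ x → when (cell (col x) ≟ u) (unitsH x))
             ++ gather (λ h → given (Q? u ×-dec ¬? (sees? u h)) (λ _ → single h))

  seenPair : ∀ u h → Q u × Sees u h → Unit G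
  seenPair u h (Qu , _) = repPair u Qu

  rowUnits : Fin n → List (Unit G)
  rowUnits h = gather (λ x → when (row x ≟ h) (unitsG x))
            ++ gather (λ u → given (Q? u ×-dec sees? u h) (seenPair u h))

  cellUnits-dominate : ∀ {u} → Q u → DominatedBy H (cellUnits u)
  cellUnits-dominate {u} Qu h with sees? u h
  ... | yes (x , x∈D , cell≡u , near) =
    let (x′ , col≡ , U , U∈ , row∈) = column-cover x∈D
    in U , ∈-++⁺ˡ (∈-gather _ x′ (∈-when (cell (col x′) ≟ u) (trans (cong cell col≡) cell≡u) U∈)) ,
       row x , row∈ , near
  ... | no ¬sees =
    let (_ , h∈) = ∈-given (Q? u ×-dec ¬? (sees? u h)) (λ _ → single h) (Qu , ¬sees)
    in single h , ∈-++⁺ʳ _ (∈-gather _ h h∈) , h , refl , inj₁ refl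

  -- The row units dominate G: if the cell of g does not see h, the vertex (g , h)
  -- is dominated by some x ∈ D in the row h adjacent to g.
  rowUnits-dominate : ∀ h → DominatedBy G (rowUnits h)
  rowUnits-dominate h g with sees? (cell g) h
  ... | yes sees =
    let ((Qc , _) , U∈) = ∈-given (Q? (cell g) ×-dec sees? (cell g) h) (seenPair (cell g) h) (cell-rep g , sees)
        (y , y∈U , near) = near-cell g Qc
    in repPair (cell g) Qc , ∈-++⁺ʳ _ (∈-gather _ (cell g) U∈) , y , y∈U , near
  ... | no ¬sees with domD (combine g h)
  ...   | x , x∈N , x∈D with product-nbhd x∈N
  ...     | inj₁ (col≡g , near) = ⊥-elim (¬sees (x , x∈D , cong cell col≡g , near))
  ...     | inj₂ (row≡h , g~col) =
    let (x′ , row≡ , U , U∈ , col∈) = row-cover x∈D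
    in U , ∈-++⁺ˡ (∈-gather _ x′ (∈-when (row x′ ≟ h) (trans row≡ row≡h) U∈)) , col x , col∈ , inj₂ g~col

  unseen : Fin m → Fin n → ℕ
  unseen u h = ind (Q? u ×-dec ¬? (sees? u h))

  fromD-cell : Fin m → ℕ
  fromD-cell u = ∑[ x < m * n ] (ind (cell (col x) ≟ u) * length (unitsH x))

  unseenRows : Fin m → ℕ
  unseenRows u = ∑[ h < n ] unseen u h

  fromD-row : Fin n → ℕ
  fromD-row h = ∑[ x < m * n ] (ind (row x ≟ h) * length (unitsG x))

  seenCells unseenCells : Fin n → ℕ
  seenCells   h = ∑[ u < m ] ind (Q? u ×-dec sees? u h)
  unseenCells h = ∑[ u < m ] unseen u h

  length-cellUnits : ∀ u → length (cellUnits u) ≡ fromD-cell u + unseenRows u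
  length-cellUnits u = trans (length-++ (gather fromD)) (cong₂ _+_
    (trans (length-gather fromD) (sum-cong-≗ (λ x → length-when (cell (col x) ≟ u) (unitsH x))))
    (trans (length-gather fromUnseen)
           (sum-cong-≗ (λ h → length-given (Q? u ×-dec ¬? (sees? u h)) (λ _ → single h)))))
    where
    fromD : Fin (m * n) → List (Unit H)
    fromD x = when (cell (col x) ≟ u) (unitsH x)
    fromUnseen : Fin n → List (Unit H)
    fromUnseen h = given (Q? u ×-dec ¬? (sees? u h)) (λ _ → single h)

  length-rowUnits : ∀ h → length (rowUnits h) ≡ fromD-row h + seenCells h
  length-rowUnits h = trans (length-++ (gather fromD)) (cong₂ _+_
    (trans (length-gather fromD) (sum-cong-≗ (λ x → length-when (row x ≟ h) (unitsG x))))
    (trans (length-gather fromSeen)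
           (sum-cong-≗ (λ u → length-given (Q? u ×-dec sees? u h) (seenPair u h)))))
    where
    fromD : Fin (m * n) → List (Unit G)
    fromD x = when (row x ≟ h) (unitsG x)
    fromSeen : Fin m → List (Unit G)
    fromSeen u = given (Q? u ×-dec sees? u h) (seenPair u h)

  seen+unseen : ∀ h → seenCells h + unseenCells h ≡ count
  seen+unseen h = trans (sym (∑-distrib-+ (λ u → ind (Q? u ×-dec sees? u h)) (λ u → unseen u h)))
                        (sum-cong-≗ (λ u → ind-split (Q? u) (sees? u h)))

  total : ℕ
  total = ∑[ x < m * n ] weight D β? x

  module _ {a b} (aP : IsPairedDomNumber G a) (bP : IsPairedDomNumber H b) (2R≤a : 2 * count ≤ a) where

    open UnitCover using (unit-cover-bound)

    cell-bound : ∀ u → ind (Q? u) * b ≤ 2 * (fromD-cell u + unseenRows u)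
    cell-bound u = ind*-≤ (Q? u) λ Qu → begin
      b                        ≤⟨ unit-cover-bound H noH bP (cellUnits u) (cellUnits-dominate Qu) ⟩
      2 * length (cellUnits u) ≡⟨ cong (2 *_) (length-cellUnits u) ⟩
      2 * (fromD-cell u + unseenRows u) ∎
      where open ≤-Reasoning

    -- The unit bound for G, for each row: since 2|Q| ≤ γpr(G), the representatives
    -- that do not see h are at most the units contributed from the row h.
    unseen-bound : ∀ h → unseenCells h ≤ fromD-row h
    unseen-bound h = +-cancelˡ-≤ (seenCells h) _ _ (*-cancelˡ-≤ 2 (begin
      2 * (seenCells h + unseenCells h) ≡⟨ cong (2 *_) (seen+unseen h) ⟩
      2 * count                         ≤⟨ 2R≤a ⟩
      a                                 ≤⟨ unit-cover-bound G noG aP (rowUnits h) (rowUnits-dominate h) ⟩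
      2 * length (rowUnits h)           ≡⟨ cong (2 *_) (trans (length-rowUnits h) (+-comm (fromD-row h) _)) ⟩
      2 * (seenCells h + fromD-row h)   ∎))
      where open ≤-Reasoning

    -- Summing over rows, the unseen pairs (cell, row) are paid by the G-side units.
    unseen-total : ∑[ u < m ] unseenRows u ≤ ∑[ x < m * n ] length (unitsG x)
    unseen-total = begin
      ∑[ u < m ] unseenRows u    ≡⟨ ∑-comm unseen ⟩
      ∑[ h < n ] unseenCells h   ≤⟨ ∑-mono unseen-bound ⟩
      ∑[ h < n ] fromD-row h     ≡⟨ ∑-fibres row (λ x → length (unitsG x)) ⟩
      ∑[ x < m * n ] length (unitsG x) ∎
      where open ≤-Reasoning

    bound : count * b ≤ 2 * total
    bound = begin
      count * b                                       ≡⟨ *-distribʳ-sum b (λ u → ind (Q? u)) ⟩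
      ∑[ u < m ] (ind (Q? u) * b)                     ≤⟨ ∑-mono cell-bound ⟩
      ∑[ u < m ] (2 * (fromD-cell u + unseenRows u))  ≡⟨ *-distribˡ-sum 2 (λ u → fromD-cell u + unseenRows u) ⟨
      2 * ∑[ u < m ] (fromD-cell u + unseenRows u)    ≡⟨ cong (2 *_) (∑-distrib-+ fromD-cell unseenRows) ⟩
      2 * (∑[ u < m ] fromD-cell u + ∑[ u < m ] unseenRows u)
        ≤⟨ *-monoʳ-≤ 2 (+-mono-≤ (≤-reflexive cells-total) unseen-total) ⟩
      2 * (∑[ x < m * n ] ℓH x + ∑[ x < m * n ] ℓG x) ≡⟨ cong (2 *_) (∑-distrib-+ ℓH ℓG) ⟨
      2 * ∑[ x < m * n ] (ℓH x + ℓG x)                ≤⟨ *-monoʳ-≤ 2 (∑-mono units-count) ⟩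
      2 * total                                       ∎
      where
      open ≤-Reasoning
      ℓH ℓG : Fin (m * n) → ℕ
      ℓH x = length (unitsH x)
      ℓG x = length (unitsG x)
      cells-total : ∑[ u < m ] fromD-cell u ≡ ∑[ x < m * n ] ℓH x
      cells-total = ∑-fibres (λ x → cell (col x)) ℓH

half : ∀ {a r s} → a ≤ 2 * s → r + s ≡ a → 2 * r ≤ a
half {a} {r} {s} a≤2s r+s≡a = begin
  2 * r  ≡⟨ cong (r +_) (+-identityʳ r) ⟩
  r + r  ≤⟨ +-monoʳ-≤ r r≤s ⟩
  r + s  ≡⟨ r+s≡a ⟩
  a      ∎
  where
  open ≤-Reasoning
  r≤s : r ≤ s
  r≤s = +-cancelʳ-≤ s r s (begin
    r + s  ≡⟨ r+s≡a ⟩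
    a      ≤⟨ a≤2s ⟩
    2 * s  ≡⟨ cong (s +_) (+-identityʳ s) ⟩
    s + s  ∎)

product-bound : ∀ {a b c r s t} → a ≤ 2 * r → r * b ≤ 2 * s → r * b ≤ 2 * t → s + t ≡ 3 * c → a * b ≤ 6 * c
product-bound {a} {b} {c} {r} {s} {t} a≤2r rb≤2s rb≤2t s+t≡3c = begin
  a * b              ≤⟨ *-monoˡ-≤ b a≤2r ⟩
  2 * r * b          ≡⟨ *-assoc 2 r b ⟩
  2 * (r * b)        ≡⟨ cong (r * b +_) (+-identityʳ (r * b)) ⟩
  r * b + r * b      ≤⟨ +-mono-≤ rb≤2s rb≤2t ⟩
  2 * s + 2 * t      ≡⟨ *-distribˡ-+ 2 s t ⟨
  2 * (s + t)        ≡⟨ cong (2 *_) s+t≡3c ⟩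
  2 * (3 * c)        ≡⟨ *-assoc 2 3 c ⟨
  6 * c              ∎
  where open ≤-Reasoning

-- Main theorem: orient both paired dominating sets, apply the representative
-- bound to the two orientations of DG (to get a = 2|Q|) and the double counting
-- to the two orientations of D.
theorem4 : ∀ {m n} (G : Graph m) (H : Graph n) →
    NoIsolated G → NoIsolated H →
    ∀ (a b c : ℕ) →
    IsPairedDomNumber G a → IsPairedDomNumber H b → IsPairedDomNumber (G □ H) c →
    a * b ≤ 6 * c
theorem4 G H noG noH a b c
         aP@((DG , (domG , pG , matchG) , ∣DG∣≡a) , _) bP ((D , (domD , p , matchD) , ∣D∣≡c) , _) =
  product-bound {c = c} {r = ByFirst.count} {s = CountFirst.total} {t = CountSecond.total}
                a≤2R (CountFirst.bound aP bP 2R≤a) (CountSecond.bound aP bP 2R≤a) weights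
  where
  module OrientG = Orientation (partner-∈ G matchG) (partner-invol G matchG) (partner-≢ G matchG)
  module OrientD = Orientation (partner-∈ (G □ H) matchD) (partner-invol (G □ H) matchD)
                               (partner-≢ (G □ H) matchD)
  module ByFirst  = Representatives G matchG domG OrientG.First?  proj₁ OrientG.first-rep
  module BySecond = Representatives G matchG domG OrientG.Second? proj₁ OrientG.second-rep

  a≤2R : a ≤ 2 * ByFirst.count
  a≤2R = ByFirst.rep-bound noG aP

  2R≤a : 2 * ByFirst.count ≤ a
  2R≤a = half {r = ByFirst.count} (BySecond.rep-bound noG aP) (trans OrientG.first+second-count ∣DG∣≡a)

  module CountFirst  = DoubleCounting G H noG noH matchG domG OrientG.First? proj₁ OrientG.first-rep
                                      matchD domD OrientD.First? OrientD.first-rep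
  module CountSecond = DoubleCounting G H noG noH matchG domG OrientG.First? proj₁ OrientG.first-rep
                                      matchD domD OrientD.Second? OrientD.second-rep

  weights : CountFirst.total + CountSecond.total ≡ 3 * c
  weights = trans OrientD.weight-total (cong (3 *_) ∣D∣≡c)
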